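{- Let $\mathcal{V}$ be a finite set and $\mathcal{F}$ a finite family of subsets of $\mathcal{V}$. Consider the process that starts from the one-part ordered partition $(\mathcal{V})$ and refines it successively by every set of $\mathcal{F}$ taken in $LF$ order. Suppose that at some step, refining by $Y\in\mathcal{F}$, a part $C$ of the current partition is split into two nonempty parts $C'=C\setminus Y$ followed by $C''=C\cap Y$. Let $X\in\mathcal{F}$ be such that $|X|\le|Y|$, $\mathrm{left}(X)\in C'$ and $\mathrm{right}(X)\in C''$. Then $Y=\mathrm{Max}(X)$.
   Context: Two sets $A,B$ overlap if $A\cap B\neq\emptyset$, $A\setminus B\neq\emptyset$ and $B\setminus A\neq\emptyset$. $LF$ is the list of all sets of $\mathcal{F}$ sorted in decreasing order of size, ties broken in an arbitrary but fixed way. For $X\in\mathcal{F}$, $\mathrm{Max}(X)$ is the first set $Y$ in $LF$ order with $|Y|\ge|X|$ that overlaps $X$ ($\mathrm{Max}(X)=\emptyset$ if none exists). Refining a part $C$ by a set $Z$: if $C\subseteq Z$ or $C\cap Z=\emptyset$ it is unchanged, otherwise it is replaced at its position by $C\setminus Z$ followed by $C\cap Z$; refining an ordered partition by $Z$ means refining all its parts. Let $P_f$ be the final ordered partition obtained after refining $(\mathcal{V})$ by all sets of $\mathcal{F}$ in $LF$ order, and fix a linear order of $\mathcal{V}$ listing the parts of $P_f$ in order (elements inside a part in an arbitrary fixed order). For $X\in\mathcal{F}$, $\mathrm{left}(X)$ (resp. $\mathrm{right}(X)$) denotes the element of $X$ that is first (resp. last) in this linear order. -}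

module Defs where

open import Data.Nat using (ℕ; _≤_; _≥_; _≤?_)
open import Data.Bool using (Bool; true; false; if_then_else_; _∧_; _∨_; not)
open import Data.Fin using (Fin)
open import Data.Fin.Subset using (Subset; _∩_; _─_; ∣_∣; ⊥; ⊤; Nonempty; _⊆_)
import Data.Fin.Subset as S
open import Data.Fin.Subset.Properties using (nonempty?; _⊆?_)
open import Data.List using (List; []; _∷_; _++_; concat; concatMap; foldl)
open import Data.List.Membership.Propositional using () renaming (_∈_ to _∈ˡ_)
open import Data.List.Relation.Unary.All using (All)
open import Data.List.Relation.Unary.Unique.Propositional using (Unique)
open import Data.List.Relation.Binary.Pointwise using (Pointwise)
open import Data.Product using (Σ; _×_; _,_)
open import Function.Bundles using (_⇔_)
open import Relation.Nullary using (¬_; does)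
open import Relation.Binary.PropositionalEquality using (_≡_)

private variable n : ℕ

overlapsᵇ : Subset n → Subset n → Bool
overlapsᵇ A B = does (nonempty? (A ∩ B)) ∧ (does (nonempty? (A ─ B)) ∧ does (nonempty? (B ─ A)))

maxOf : List (Subset n) → Subset n → Subset n
maxOf [] X = ⊥
maxOf (Y ∷ LF) X =
  if does (∣ X ∣ ≤? ∣ Y ∣) ∧ overlapsᵇ X Y then Y else maxOf LF X

refinePart : Subset n → Subset n → List (Subset n)
refinePart Z C =
  if does (C ⊆? Z) ∨ not (does (nonempty? (C ∩ Z)))
  then C ∷ []
  else (C ─ Z) ∷ (C ∩ Z) ∷ []

refine : List (Subset n) → Subset n → List (Subset n)
refine P Z = concatMap (refinePart Z) P

refineAll : List (Subset n) → List (Subset n)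
refineAll L = foldl refine (⊤ ∷ []) L

SortedDecr : List (Subset n) → Set
SortedDecr = Data.List.Relation.Unary.AllPairs.AllPairs (λ A B → ∣ B ∣ ≤ ∣ A ∣)
  where import Data.List.Relation.Unary.AllPairs

-- ord is a linear order of 𝒱 listing the parts of P in order,
-- elements inside a part in some order (each part enumerated without repetition).
Enumerates : List (Fin n) → Subset n → Set
Enumerates {n} L C = Unique L × ((x : Fin n) → (x ∈ˡ L) ⇔ (x S.∈ C))

IsLinearOrderFor : List (Subset n) → List (Fin n) → Set
IsLinearOrderFor {n} P ord =
  Σ (List (List (Fin n))) λ Ls → Pointwise Enumerates Ls P × ord ≡ concat Ls

IsLeft : List (Fin n) → Subset n → Fin n → Set
IsLeft {n} ord X x = Σ (List (Fin n)) λ pre → Σ (List (Fin n)) λ suf →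
  ord ≡ pre ++ (x ∷ suf) × x S.∈ X × All (λ y → y S.∉ X) pre

IsRight : List (Fin n) → Subset n → Fin n → Set
IsRight {n} ord X x = Σ (List (Fin n)) λ pre → Σ (List (Fin n)) λ suf →
  ord ≡ pre ++ (x ∷ suf) × x S.∈ X × All (λ y → y S.∉ X) suf

-- Every part of the partition reached just before Y is, for each earlier set Z, either
-- inside Z or disjoint from it, and later steps only split parts, so the final order
-- lists each such part as a contiguous block. Hence X, whose first and last elements lie
-- in the part C, is contained in C and overlaps no set preceding Y. But X overlaps Y:
-- r ∈ X ∩ Y, l ∈ X ∖ Y, and Y ⊄ X since |X| ≤ |Y|. So Y is the first set of size at
-- least |X| overlapping X.

module Submission where

open import Defs
open import Data.Nat using (ℕ; _≤_)
open import Data.Fin using (Fin)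
open import Data.Fin.Subset using (Subset; _∩_; _─_; ∣_∣; Nonempty)
import Data.Fin.Subset as S
open import Data.List using (List; _∷_; _++_)
open import Data.List.Membership.Propositional using (_∈_)
open import Data.List.Relation.Unary.Unique.Propositional using (Unique)
open import Relation.Binary.PropositionalEquality using (_≡_)

open import Data.Nat using (_≤?_)
open import Data.Nat.Properties using (<⇒≱)
open import Data.Bool using (true; false)
open import Data.Bool.Properties using (∧-zeroʳ)
open import Data.Vec.Base as Vec using (_∷_)
open import Data.Fin.Subset using (Empty; _⊆_; ⊤; inside)
open import Data.Fin.Subset.Properties
  using (x∈p∩q⁺; x∈p∩q⁻; x∈p∧x∉q⇒x∈p─q; p─q⊆p; ∈⊤; p⊂q⇒∣p∣<∣q∣; nonempty?; _∈?_; _⊆?_)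
open import Data.List using ([]; concat; foldl)
open import Data.List.Membership.Propositional using (_∉_)
open import Data.List.Membership.Propositional.Properties using (∈-++⁺ˡ; ∈-++⁺ʳ; ∈-++⁻)
open import Data.List.Properties using (foldl-++; concat-++; ∷-injective; ++-assoc)
open import Data.List.Relation.Binary.Subset.Propositional using () renaming (_⊆_ to _⊆ˡ_)
open import Data.List.Relation.Unary.Any using (Any; here; there)
import Data.List.Relation.Unary.Any as Any
import Data.List.Relation.Unary.Any.Properties as Any
open import Data.List.Relation.Unary.All using (All; []; _∷_)
import Data.List.Relation.Unary.All as All
import Data.List.Relation.Unary.All.Properties as All
open import Data.List.Relation.Unary.AllPairs using (AllPairs; []; _∷_)
import Data.List.Relation.Unary.AllPairs as AllPairs
import Data.List.Relation.Unary.AllPairs.Properties as AllPairs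
open import Data.List.Relation.Binary.Pointwise using (Pointwise; []; _∷_)
import Data.List.Relation.Binary.Pointwise as Pointwise
open import Data.Product using (Σ-syntax; ∃-syntax; _×_; _,_; proj₁; proj₂)
open import Data.Sum using (_⊎_; inj₁; inj₂)
open import Function.Bundles using (_⇔_; mk⇔; Equivalence)
open import Relation.Nullary using (yes; no; does; contradiction)
open import Relation.Nullary.Decidable using (dec-true; dec-false)
open import Relation.Binary.PropositionalEquality using (refl; sym; trans; cong; subst; module ≡-Reasoning)

private variable
  m : ℕ
  x : Fin m
  p q C D E X Y Z : Subset m
  P L : List (Subset m)
  ord : List (Fin m)
  Ms : List (List (Fin m))

x∈p─q⇒x∉q : ∀ (p q : Subset m) → x S.∈ p ─ q → x S.∉ q
x∈p─q⇒x∉q (_ ∷ p) (_ ∷ q) (Vec.there x∈p─q) (Vec.there x∈q) = x∈p─q⇒x∉q p q x∈p─q x∈q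
x∈p─q⇒x∉q (_ ∷ p) (inside ∷ q) () Vec.here

Disjoint : Subset m → Subset m → Set
Disjoint p q = Empty (p ∩ q)

Disjoint⇒∉ : Disjoint p q → x S.∈ p → x S.∉ q
Disjoint⇒∉ p#q x∈p x∈q = p#q (_ , x∈p∩q⁺ (x∈p , x∈q))

Disjoint-mono : D ⊆ p → E ⊆ q → Disjoint p q → Disjoint D E
Disjoint-mono {D = D} {E = E} D⊆p E⊆q p#q (x , x∈D∩E) =
  let x∈D , x∈E = x∈p∩q⁻ D E x∈D∩E in Disjoint⇒∉ p#q (D⊆p x∈D) (E⊆q x∈E)

p─q#q : ∀ (p q : Subset m) → Disjoint (p ─ q) q
p─q#q p q (x , x∈p─q∩q) = let x∈p─q , x∈q = x∈p∩q⁻ (p ─ q) q x∈p─q∩q in x∈p─q⇒x∉q p q x∈p─q x∈q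

-- Exactly the parts D that refinePart Z leaves unchanged.
Aligned : Subset m → Subset m → Set
Aligned D Z = D ⊆ Z ⊎ Disjoint D Z

Aligned-⊆ : D ⊆ C → Aligned C Z → Aligned D Z
Aligned-⊆ D⊆C (inj₁ C⊆Z) = inj₁ λ x∈D → C⊆Z (D⊆C x∈D)
Aligned-⊆ D⊆C (inj₂ C#Z) = inj₂ (Disjoint-mono D⊆C (λ x∈Z → x∈Z) C#Z)

∣p∣≤∣q∣∧p─q≢∅⇒q─p≢∅ : ∣ p ∣ ≤ ∣ q ∣ → Nonempty (p ─ q) → Nonempty (q ─ p)
∣p∣≤∣q∣∧p─q≢∅⇒q─p≢∅ {p = p} {q} ∣p∣≤∣q∣ (x , x∈p─q) with nonempty? (q ─ p)
... | yes q─p≢∅ = q─p≢∅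
... | no q─p≡∅ =
  contradiction ∣p∣≤∣q∣ (<⇒≱ (p⊂q⇒∣p∣<∣q∣ (q⊆p , x , p─q⊆p p q x∈p─q , x∈p─q⇒x∉q p q x∈p─q)))
  where
  q⊆p : q ⊆ p
  q⊆p {y} y∈q with y ∈? p
  ... | yes y∈p = y∈p
  ... | no y∉p = contradiction (y , x∈p∧x∉q⇒x∈p─q y∈q y∉p) q─p≡∅

overlapsᵇ-true : Nonempty (p ∩ q) → Nonempty (p ─ q) → Nonempty (q ─ p) → overlapsᵇ p q ≡ true
overlapsᵇ-true {p = p} {q} p∩q≢∅ p─q≢∅ q─p≢∅
  rewrite dec-true (nonempty? (p ∩ q)) p∩q≢∅
        | dec-true (nonempty? (p ─ q)) p─q≢∅
        | dec-true (nonempty? (q ─ p)) q─p≢∅ = refl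

Aligned⇒overlapsᵇ-false : Aligned p q → overlapsᵇ p q ≡ false
Aligned⇒overlapsᵇ-false {p = p} {q} (inj₁ p⊆q)
  rewrite dec-false (nonempty? (p ─ q)) λ (x , x∈p─q) → x∈p─q⇒x∉q p q x∈p─q (p⊆q (p─q⊆p p q x∈p─q))
  = ∧-zeroʳ _
Aligned⇒overlapsᵇ-false {p = p} {q} (inj₂ p#q) rewrite dec-false (nonempty? (p ∩ q)) p#q = refl

maxOf-skip : ∀ pre → All (λ Z → overlapsᵇ X Z ≡ false) pre → maxOf (pre ++ L) X ≡ maxOf L X
maxOf-skip [] [] = refl
maxOf-skip {X = X} (Z ∷ pre) (X∦Z ∷ X∦pre)
  rewrite X∦Z | ∧-zeroʳ (does (∣ X ∣ ≤? ∣ Z ∣)) = maxOf-skip pre X∦pre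

maxOf-hit : ∣ X ∣ ≤ ∣ Y ∣ → overlapsᵇ X Y ≡ true → maxOf (Y ∷ L) X ≡ Y
maxOf-hit {X = X} {Y} ∣X∣≤∣Y∣ X∥Y rewrite dec-true (∣ X ∣ ≤? ∣ Y ∣) ∣X∣≤∣Y∣ | X∥Y = refl

data RefinePartView (Z C : Subset m) : List (Subset m) → Set where
  unsplit : Aligned C Z → RefinePartView Z C (C ∷ [])
  split   : RefinePartView Z C ((C ─ Z) ∷ (C ∩ Z) ∷ [])

refinePart-view : ∀ (Z C : Subset m) → RefinePartView Z C (refinePart Z C)
refinePart-view Z C with C ⊆? Z | nonempty? (C ∩ Z)
... | yes C⊆Z | _      = unsplit (inj₁ C⊆Z)
... | no _    | yes _  = split
... | no _    | no C#Z = unsplit (inj₂ C#Z)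

module _ {Z C : Subset m} where

  view-⊆ : RefinePartView Z C L → All (_⊆ C) L
  view-⊆ (unsplit _) = (λ x∈C → x∈C) ∷ []
  view-⊆ split       = p─q⊆p C Z ∷ (λ x∈C∩Z → proj₁ (x∈p∩q⁻ C Z x∈C∩Z)) ∷ []

  view-aligned : RefinePartView Z C L → All (λ D → Aligned D Z) L
  view-aligned (unsplit C∥Z) = C∥Z ∷ []
  view-aligned split         = inj₂ (p─q#q C Z) ∷ inj₁ (λ x∈C∩Z → proj₂ (x∈p∩q⁻ C Z x∈C∩Z)) ∷ []

  view-disjoint : RefinePartView Z C L → AllPairs Disjoint L
  view-disjoint (unsplit _) = [] ∷ []
  view-disjoint split =
    (Disjoint-mono (λ x∈C─Z → x∈C─Z) (λ x∈C∩Z → proj₂ (x∈p∩q⁻ C Z x∈C∩Z)) (p─q#q C Z) ∷ [])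
    ∷ [] ∷ []

  view-covers : RefinePartView Z C L → x S.∈ C → Any (x S.∈_) L
  view-covers (unsplit _) x∈C = here x∈C
  view-covers {x = x} split x∈C with x ∈? Z
  ... | yes x∈Z = there (here (x∈p∩q⁺ (x∈C , x∈Z)))
  ... | no x∉Z  = here (x∈p∧x∉q⇒x∈p─q x∈C x∉Z)

refine-inherits : ∀ {Q : Subset m → Set} →
  (∀ {D C} → D ⊆ C → Q C → Q D) → All Q P → All Q (refine P Z)
refine-inherits {Z = Z} ⊆-closed QP = All.concat⁺ (All.map⁺ (All.map
  (λ {C} QC → All.map (λ {D} (D⊆C : D ⊆ C) → ⊆-closed D⊆C QC) (view-⊆ (refinePart-view Z C))) QP))

refine-aligned : ∀ P → All (λ D → Aligned D Z) (refine P Z)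
refine-aligned {Z = Z} P =
  All.concat⁺ (All.map⁺ (All.universal (λ C → view-aligned (refinePart-view Z C)) P))

foldl-refine-inherits : ∀ {Q : Subset m → Set} L →
  (∀ {D C} → D ⊆ C → Q C → Q D) → All Q P → All Q (foldl refine P L)
foldl-refine-inherits []      _        QP = QP
foldl-refine-inherits (Z ∷ L) ⊆-closed QP =
  foldl-refine-inherits L ⊆-closed (refine-inherits ⊆-closed QP)

foldl-refine-aligned : ∀ L → All (λ D → All (Aligned D) L) (foldl refine P L)
foldl-refine-aligned {P = P} [] = All.universal (λ _ → []) P
foldl-refine-aligned {P = P} (Z ∷ L) = All.zipWith (λ (D∥Z , D∥L) → D∥Z ∷ D∥L)
  (foldl-refine-inherits L Aligned-⊆ (refine-aligned P) , foldl-refine-aligned L)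

record IsPartition (P : List (Subset m)) : Set where
  field
    disjoint : AllPairs Disjoint P
    covers   : ∀ x → Any (x S.∈_) P

open IsPartition

refine-partition : IsPartition P → IsPartition (refine P Z)
refine-partition {P = P} {Z = Z} part = record
  { disjoint = AllPairs.concat⁺
      (All.map⁺ (All.universal (λ C → view-disjoint (refinePart-view Z C)) P))
      (AllPairs.map⁺ (AllPairs.map split-disjoint (disjoint part)))
  ; covers = λ x → Any.concat⁺ (Any.map⁺
      (Any.map (λ {C} x∈C → view-covers (refinePart-view Z C) x∈C) (covers part x)))
  }
  where
  split-disjoint : ∀ {C C′} → Disjoint C C′ →
    All (λ D → All (Disjoint D) (refinePart Z C′)) (refinePart Z C)
  split-disjoint {C} {C′} C#C′ = All.map
    (λ {D} (D⊆C : D ⊆ C) → All.map (λ {E} (E⊆C′ : E ⊆ C′) → Disjoint-mono D⊆C E⊆C′ C#C′) (view-⊆ (refinePart-view Z C′)))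
    (view-⊆ (refinePart-view Z C))

refineAll-partition : ∀ (L : List (Subset m)) → IsPartition (refineAll L)
refineAll-partition L = go L record { disjoint = [] ∷ [] ; covers = λ _ → here ∈⊤ }
  where
  go : ∀ L → IsPartition P → IsPartition (foldl refine P L)
  go []      part = part
  go (Z ∷ L) part = go L (refine-partition part)

Lists : List (Fin m) → Subset m → Set
Lists {m} M C = (x : Fin m) → x ∈ M ⇔ x S.∈ C

ListsInOrder : List (Subset m) → List (Fin m) → Set
ListsInOrder {m} P ord = Σ[ Ms ∈ List (List (Fin m)) ] Pointwise Lists Ms P × ord ≡ concat Ms

IsLinearOrderFor⇒ListsInOrder : IsLinearOrderFor P ord → ListsInOrder P ord
IsLinearOrderFor⇒ListsInOrder (Ms , enumerates , ord≡) = Ms , Pointwise.map proj₂ enumerates , ord≡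

concat-lists : Pointwise Lists Ms P → x ∈ concat Ms ⇔ Any (x S.∈_) P
concat-lists []                = mk⇔ (λ ()) (λ ())
concat-lists {Ms = M ∷ Ms} {P = C ∷ P} {x = x} (M-lists ∷ Ms-list) = mk⇔ to from
  where
  to : x ∈ M ++ concat Ms → Any (x S.∈_) (C ∷ P)
  to x∈ with ∈-++⁻ M x∈
  ... | inj₁ x∈M  = here (Equivalence.to (M-lists x) x∈M)
  ... | inj₂ x∈Ms = there (Equivalence.to (concat-lists Ms-list) x∈Ms)
  from : Any (x S.∈_) (C ∷ P) → x ∈ M ++ concat Ms
  from (here x∈C)  = ∈-++⁺ˡ (Equivalence.from (M-lists x) x∈C)
  from (there x∈P) = ∈-++⁺ʳ M (Equivalence.from (concat-lists Ms-list) x∈P)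

ListsInOrder-∈ : ListsInOrder P ord → Any (x S.∈_) P → x ∈ ord
ListsInOrder-∈ (_ , lists , refl) = Equivalence.from (concat-lists lists)

view-lists : ∀ {Z C : Subset m} {L} → RefinePartView Z C L → Pointwise Lists Ms L → Lists (concat Ms) C
view-lists {C = C} view lists x = mk⇔
  (λ x∈Ms → All.lookupWith (λ D⊆C x∈D → D⊆C x∈D) (view-⊆ view) (Equivalence.to (concat-lists lists) x∈Ms))
  (λ x∈C → Equivalence.from (concat-lists lists) (view-covers view x∈C))

Pointwise-++⁻ : ∀ {A B : Set} {R : A → B → Set} (ys ys′ : List B) {xs} → Pointwise R xs (ys ++ ys′) →
  ∃[ zs ] ∃[ zs′ ] xs ≡ zs ++ zs′ × Pointwise R zs ys × Pointwise R zs′ ys′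
Pointwise-++⁻ []       ys′ rs       = [] , _ , refl , [] , rs
Pointwise-++⁻ (y ∷ ys) ys′ (r ∷ rs) with Pointwise-++⁻ ys ys′ rs
... | zs , zs′ , refl , rs₁ , rs₂ = _ ∷ zs , zs′ , refl , r ∷ rs₁ , rs₂

refine-coarsens : ∀ P → ListsInOrder (refine P Z) ord → ListsInOrder P ord
refine-coarsens [] ([] , [] , refl) = [] , [] , refl
refine-coarsens {Z = Z} (C ∷ P) (Ms , lists , refl)
  with Pointwise-++⁻ (refinePart Z C) (refine P Z) lists
... | M₁ , M₂ , refl , lists₁ , lists₂ with refine-coarsens P (M₂ , lists₂ , refl)
... | Ns , listsN , M₂≡Ns = concat M₁ ∷ Ns , view-lists (refinePart-view Z C) lists₁ ∷ listsN ,
  (begin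
    concat (M₁ ++ M₂)       ≡⟨ concat-++ M₁ M₂ ⟨
    concat M₁ ++ concat M₂  ≡⟨ cong (concat M₁ ++_) M₂≡Ns ⟩
    concat M₁ ++ concat Ns  ∎)
  where open ≡-Reasoning

foldl-refine-coarsens : ∀ P L → ListsInOrder (foldl refine P L) ord → ListsInOrder P ord
foldl-refine-coarsens P []      listing = listing
foldl-refine-coarsens P (Z ∷ L) listing = refine-coarsens P (foldl-refine-coarsens (refine P Z) L listing)

ListsInOrder-part : AllPairs Disjoint P → ListsInOrder P ord → C ∈ P →
  ∃[ A ] ∃[ M ] ∃[ B ] ord ≡ A ++ M ++ B × Lists M C × All (S._∉ C) A × All (S._∉ C) B
ListsInOrder-part (C#P ∷ _) (M ∷ Ms , M-lists ∷ Ms-list , refl) (here refl) =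
  [] , M , concat Ms , refl , M-lists , [] ,
  All.tabulate λ x∈Ms → All.lookupWith (λ C#D x∈D x∈C → Disjoint⇒∉ C#D x∈C x∈D) C#P
                          (Equivalence.to (concat-lists Ms-list) x∈Ms)
ListsInOrder-part {C = C} (D#P ∷ P#) (N ∷ Ms , N-lists ∷ Ms-list , refl) (there C∈P)
  with ListsInOrder-part P# (Ms , Ms-list , refl) C∈P
... | A , M , B , Ms≡ , M-lists , A∌C , B∌C =
  N ++ A , M , B , trans (cong (N ++_) Ms≡) (sym (++-assoc N A (M ++ B))) , M-lists ,
  All.++⁺ (All.tabulate λ {x} x∈N → Disjoint⇒∉ (All.lookup D#P C∈P) (Equivalence.to (N-lists x) x∈N)) A∌C ,
  B∌C

module _ {T : Set} where

  prefix⊆before : ∀ (xs : List T) {ys pre suf x} → xs ++ ys ≡ pre ++ x ∷ suf → x ∉ xs → xs ⊆ˡ pre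
  prefix⊆before (y ∷ xs) {pre = []}      eq x∉ _         = contradiction (here (sym (proj₁ (∷-injective eq)))) x∉
  prefix⊆before (y ∷ xs) {pre = p ∷ pre} eq x∉ (here refl) = here (proj₁ (∷-injective eq))
  prefix⊆before (y ∷ xs) {pre = p ∷ pre} eq x∉ (there z∈) =
    there (prefix⊆before xs (proj₂ (∷-injective eq)) (λ x∈ → x∉ (there x∈)) z∈)

  suffix⊆after : ∀ (xs : List T) {ys pre suf x} → xs ++ ys ≡ pre ++ x ∷ suf → x ∉ ys → ys ⊆ˡ suf
  suffix⊆after []       {pre = pre}     refl x∉ _  = contradiction (∈-++⁺ʳ pre (here refl)) x∉
  suffix⊆after (y ∷ xs) {pre = []}      eq   x∉ z∈ = subst (_ ∈_) (proj₂ (∷-injective eq)) (∈-++⁺ʳ xs z∈)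
  suffix⊆after (y ∷ xs) {pre = p ∷ pre} eq   x∉ = suffix⊆after xs (proj₂ (∷-injective eq)) x∉

ends-in-part⇒⊆ : ∀ {l r} → IsPartition P → ListsInOrder P ord → C ∈ P →
  IsLeft ord X l → IsRight ord X r → l S.∈ C → r S.∈ C → X ⊆ C
ends-in-part⇒⊆ {P = P} {ord} {C} {X} {l} {r} part listing C∈P
  (pl , _ , ord≡pl++l∷ , _ , pl∌X) (_ , sr , ord≡pr++r∷ , _ , sr∌X) l∈C r∈C {x} x∈X
  with ListsInOrder-part (disjoint part) listing C∈P
... | A , M , B , ord≡ , M-lists , A∌C , B∌C
  with ∈-++⁻ A (subst (x ∈_) ord≡ (ListsInOrder-∈ listing (covers part x)))
... | inj₁ x∈A = contradiction x∈X (All.lookup pl∌X (A⊆pl x∈A))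
  where
  A⊆pl : A ⊆ˡ pl
  A⊆pl = prefix⊆before A (trans (sym ord≡) ord≡pl++l∷) (λ l∈A → All.lookup A∌C l∈A l∈C)
... | inj₂ x∈M++B with ∈-++⁻ M x∈M++B
...   | inj₁ x∈M = Equivalence.to (M-lists x) x∈M
...   | inj₂ x∈B = contradiction x∈X (All.lookup sr∌X (B⊆sr x∈B))
  where
  B⊆sr : B ⊆ˡ sr
  B⊆sr = suffix⊆after (A ++ M) (trans (++-assoc A M B) (trans (sym ord≡) ord≡pr++r∷))
           (λ r∈B → All.lookup B∌C r∈B r∈C)

lemma8 : (n : ℕ) (LF : List (Subset n)) → Unique LF → SortedDecr LF →
         (ord : List (Fin n)) → IsLinearOrderFor (refineAll LF) ord →
         (pre post : List (Subset n)) (Y : Subset n) → LF ≡ pre ++ (Y ∷ post) →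
         (C : Subset n) → C ∈ refineAll pre →
         Nonempty (C ─ Y) → Nonempty (C ∩ Y) →
         (X : Subset n) → X ∈ LF → ∣ X ∣ ≤ ∣ Y ∣ →
         (l r : Fin n) → IsLeft ord X l → IsRight ord X r →
         l S.∈ (C ─ Y) → r S.∈ (C ∩ Y) →
         Y ≡ maxOf LF X
lemma8 n LF _ _ ord linear pre post Y refl C C∈ _ _ X _ ∣X∣≤∣Y∣ l r
  left@(_ , _ , _ , l∈X , _) right@(_ , _ , _ , r∈X , _) l∈C─Y r∈C∩Y =
  sym (begin
    maxOf (pre ++ Y ∷ post) X  ≡⟨ maxOf-skip pre X∦pre ⟩
    maxOf (Y ∷ post) X         ≡⟨ maxOf-hit {L = post} ∣X∣≤∣Y∣ (overlapsᵇ-true X∩Y≢∅ X─Y≢∅ Y─X≢∅) ⟩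
    Y                          ∎)
  where
  open ≡-Reasoning
  r∈C : r S.∈ C
  r∈C = proj₁ (x∈p∩q⁻ C Y r∈C∩Y)

  r∈Y : r S.∈ Y
  r∈Y = proj₂ (x∈p∩q⁻ C Y r∈C∩Y)

  listing : ListsInOrder (refineAll pre) ord
  listing = foldl-refine-coarsens (refineAll pre) (Y ∷ post)
    (subst (λ P → ListsInOrder P ord) (foldl-++ refine (⊤ ∷ []) pre (Y ∷ post))
      (IsLinearOrderFor⇒ListsInOrder linear))

  X⊆C : X ⊆ C
  X⊆C = ends-in-part⇒⊆ (refineAll-partition pre) listing C∈ left right (p─q⊆p C Y l∈C─Y) r∈C

  X∦pre : All (λ Z → overlapsᵇ X Z ≡ false) pre
  X∦pre = All.map (λ C∥Z → Aligned⇒overlapsᵇ-false (Aligned-⊆ X⊆C C∥Z))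
                  (All.lookup (foldl-refine-aligned pre) C∈)

  X∩Y≢∅ : Nonempty (X ∩ Y)
  X∩Y≢∅ = r , x∈p∩q⁺ (r∈X , r∈Y)

  X─Y≢∅ : Nonempty (X ─ Y)
  X─Y≢∅ = l , x∈p∧x∉q⇒x∈p─q l∈X (x∈p─q⇒x∉q C Y l∈C─Y)

  Y─X≢∅ : Nonempty (Y ─ X)
  Y─X≢∅ = ∣p∣≤∣q∣∧p─q≢∅⇒q─p≢∅ ∣X∣≤∣Y∣ X─Y≢∅
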